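{- For integers $c$, $d$, $k$, $q$, $v$, and $y(c)$ such that $q$ is a prime power, $2 \le d/2 \le k \le v/2$, $0 \le c \le k-d/2-1$, $0 \le y(c) \le d/2$, $2 \le d/2$, and $2 \le v-k$ let \[f(c)=\frac{\binom{v-k}{y(c)}_q\binom{k}{c}_q}{\binom{k-d/2}{c}_q\binom{d/2}{y(c)}_q} q^{c(v-k-d/2)}\text{.}\] If $y(c+1) = y(c)$ or $y(c+1) = y(c)-1 \ge 0$, then $f(c) \le f(c+1)$.
   Context: $\binom{n}{m}_q=\prod_{i=0}^{m-1}\frac{q^n-q^i}{q^m-q^i}$ denotes the Gaussian ($q$-)binomial coefficient for $0\le m\le n$, and $0$ otherwise. -}

module Defs where

open import Data.Nat as ℕ using (ℕ; zero; suc; _≤?_)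
open import Data.Integer as ℤ using (+_)
open import Data.Rational using (ℚ; 0ℚ; 1ℚ; _*_; _-_; _÷_; ≢-nonZero; _/_)
open import Data.Rational.Properties using (_≟_)
open import Relation.Nullary using (yes; no)
open import Data.Product using (Σ; _×_)
open import Data.Nat.Primality using (Prime)
open import Relation.Binary.PropositionalEquality using (_≡_)

ℕ→ℚ : ℕ → ℚ
ℕ→ℚ n = (+ n) / 1

-- total division on ℚ: x ÷' y = x / y when y ≠ 0 (and 0 otherwise;
-- this case never arises in the uses below since all denominators are nonzero)
_÷'_ : ℚ → ℚ → ℚ
x ÷' y with y ≟ 0ℚ
... | yes _ = 0ℚ
... | no y≢0 = _÷_ x y {{≢-nonZero y≢0}}

gaussProd : (q n m j : ℕ) → ℚ
gaussProd q n m zero = 1ℚ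
gaussProd q n m (suc i) =
  gaussProd q n m i * ((ℕ→ℚ (q ℕ.^ n) - ℕ→ℚ (q ℕ.^ i)) ÷' (ℕ→ℚ (q ℕ.^ m) - ℕ→ℚ (q ℕ.^ i)))

gauss : (q n m : ℕ) → ℚ
gauss q n m with m ≤? n
... | yes _ = gaussProd q n m m
... | no _ = 0ℚ

IsPrimePower : ℕ → Set
IsPrimePower q = Σ ℕ λ p → Σ ℕ λ e → Prime p × 1 ℕ.≤ e × q ≡ p ℕ.^ e

-- f(c) with δ = d/2 and y = y(c):
-- [v-k choose y]_q [k choose c]_q / ([k-δ choose c]_q [δ choose y]_q) * q^(c(v-k-δ))
fval : (q v k δ c y : ℕ) → ℚ
fval q v k δ c y =
  ((gauss q (v ℕ.∸ k) y * gauss q k c) ÷' (gauss q (k ℕ.∸ δ) c * gauss q δ y))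
    * ℕ→ℚ (q ℕ.^ (c ℕ.* (v ℕ.∸ k ℕ.∸ δ)))

module Submission where

-- Writing [n; m]′ = ∏_{i<m} (q^n - q^i), the Gaussian binomial is [n; m]′ / [m; m]′, so the
-- factors [c; c]′ and [y; y]′ cancel in f: with δ = d/2 and e = v - k - δ,
-- f(c) = [v-k; y]′ [k; c]′ q^(c e) / ([k-δ; c]′ [δ; y]′).
-- Passing from c to c + 1 with y fixed multiplies f by (q^k - q^c) q^e / (q^(k-δ) - q^c) ≥ 1.
-- If y also drops to y′ = y - 1, f is further multiplied by (q^δ - q^y′) / (q^(v-k) - q^y′), and the
-- product is still ≥ 1 because q^(v-k) - q^y′ ≤ q^δ q^e ≤ q^δ q^e (q^δ - q^y′) and
-- q^δ (q^(k-δ) - q^c) ≤ q^k - q^c.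

open import Defs
open import Data.Nat using (ℕ; _≤_; _+_; _*_; _∸_; _/_)
open import Data.Nat.Divisibility using (_∣_)
open import Data.Rational using () renaming (_≤_ to _≤ℚ_)
open import Data.Product using (_×_)
open import Data.Sum using (_⊎_)
open import Relation.Binary.PropositionalEquality using (_≡_)

open import Data.Nat using (zero; suc; _<_; _^_; z<s; NonZero; >-nonZero; nonTrivial⇒n>1)
open import Data.Nat.Primality using (prime⇒nonTrivial)
open import Data.Nat.Properties
open import Data.Nat.Coprimality using (1-coprimeTo) renaming (sym to coprime-sym)
open import Data.Integer as ℤ using (+_)
import Data.Integer.Properties as ℤP
open import Data.Rational as ℚ using (ℚ; mkℚ; 0ℚ; ↥_; _-_) renaming (_*_ to _·_)
import Data.Rational.Properties as ℚP
open import Data.Product using (_,_)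
open import Data.Sum using (inj₁; inj₂; map₂)
open import Relation.Binary.PropositionalEquality
  using (refl; sym; trans; cong; cong₂; subst; subst₂; _≢_; module ≡-Reasoning)
open import Relation.Nullary using (yes; no; contradiction)
open import Data.Empty using (⊥-elim)
open import Algebra.Bundles using (CommutativeMonoid)
open import Data.Nat.Solver using (module +-*-Solver)
open +-*-Solver using (solve; _:*_; _:=_)

private
  -- ℕ→ℚ n is a normalised fraction, so the arithmetic operations of ℚ only
  -- compute on it after it is replaced by this literal.
  literal : ℕ → ℚ
  literal n = mkℚ (+ n) 0 (coprime-sym (1-coprimeTo n))

  ℕ→ℚ≡literal : ∀ n → ℕ→ℚ n ≡ literal n
  ℕ→ℚ≡literal n = ℚP.↥p/↧p≡p (literal n)

ℕ→ℚ-+ : ∀ m n → ℕ→ℚ (m + n) ≡ ℕ→ℚ m ℚ.+ ℕ→ℚ n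
ℕ→ℚ-+ m n rewrite ℕ→ℚ≡literal m | ℕ→ℚ≡literal n =
  cong (ℚ._/ 1) (trans (ℤP.pos-+ m n)
    (sym (cong₂ ℤ._+_ (ℤP.*-identityʳ (+ m)) (ℤP.*-identityʳ (+ n)))))

ℕ→ℚ-* : ∀ m n → ℕ→ℚ (m * n) ≡ ℕ→ℚ m · ℕ→ℚ n
ℕ→ℚ-* m n rewrite ℕ→ℚ≡literal m | ℕ→ℚ≡literal n = cong (ℚ._/ 1) (ℤP.pos-* m n)

ℕ→ℚ-∸ : ∀ {m n} → n ≤ m → ℕ→ℚ (m ∸ n) ≡ ℕ→ℚ m - ℕ→ℚ n
ℕ→ℚ-∸ {m} {n} n≤m = begin
  ℕ→ℚ (m ∸ n)                         ≡⟨ ℚP.+-identityʳ (ℕ→ℚ (m ∸ n)) ⟨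
  ℕ→ℚ (m ∸ n) ℚ.+ 0ℚ                  ≡⟨ cong (ℕ→ℚ (m ∸ n) ℚ.+_) (ℚP.+-inverseʳ (ℕ→ℚ n)) ⟨
  ℕ→ℚ (m ∸ n) ℚ.+ (ℕ→ℚ n - ℕ→ℚ n)     ≡⟨ ℚP.+-assoc (ℕ→ℚ (m ∸ n)) (ℕ→ℚ n) (ℚ.- ℕ→ℚ n) ⟨
  (ℕ→ℚ (m ∸ n) ℚ.+ ℕ→ℚ n) - ℕ→ℚ n     ≡⟨ cong (_- ℕ→ℚ n) (ℕ→ℚ-+ (m ∸ n) n) ⟨
  ℕ→ℚ (m ∸ n + n) - ℕ→ℚ n             ≡⟨ cong (λ x → ℕ→ℚ x - ℕ→ℚ n) (m∸n+n≡m n≤m) ⟩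
  ℕ→ℚ m - ℕ→ℚ n                       ∎
  where open ≡-Reasoning

ℕ→ℚ-injective : ∀ {m n} → ℕ→ℚ m ≡ ℕ→ℚ n → m ≡ n
ℕ→ℚ-injective {m} {n} eq =
  ℤP.+-injective (cong ↥_ (trans (sym (ℕ→ℚ≡literal m)) (trans eq (ℕ→ℚ≡literal n))))

ℕ→ℚ-mono-≤ : ∀ {m n} → m ≤ n → ℕ→ℚ m ≤ℚ ℕ→ℚ n
ℕ→ℚ-mono-≤ {m} {n} m≤n rewrite ℕ→ℚ≡literal m | ℕ→ℚ≡literal n =
  ℚ.*≤* (subst₂ ℤ._≤_ (sym (ℤP.*-identityʳ (+ m))) (sym (ℤP.*-identityʳ (+ n)))
    (ℤ.+≤+ m≤n))

ℕ→ℚ-positive : ∀ {n} → 0 < n → ℚ.Positive (ℕ→ℚ n)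
ℕ→ℚ-positive {n} 0<n = ℚP.normalize-pos n 1 {{_}} {{>-nonZero 0<n}}

ℕ→ℚ-≢0 : ∀ {n} → 0 < n → ℕ→ℚ n ≢ 0ℚ
ℕ→ℚ-≢0 {suc n} _ eq = 1+n≢0 (ℕ→ℚ-injective {suc n} {0} eq)

÷'-·-cancel : ∀ x {y} → y ≢ 0ℚ → (x ÷' y) · y ≡ x
÷'-·-cancel x {y} y≢0 with y ℚP.≟ 0ℚ
... | yes y≡0 = ⊥-elim (y≢0 y≡0)
... | no y≢0′ = begin
  x ℚ.÷ y · y         ≡⟨ ℚP.*-assoc x (ℚ.1/ y) y ⟩
  x · (ℚ.1/ y · y)    ≡⟨ cong (x ·_) (ℚP.*-inverseˡ y) ⟩
  x · ℚ.1ℚ            ≡⟨ ℚP.*-identityʳ x ⟩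
  x                   ∎
  where
  open ≡-Reasoning
  instance
    y-nonZero : ℚ.NonZero y
    y-nonZero = ℚ.≢-nonZero y≢0′

record IsQuotient (x : ℚ) (m a : ℕ) : Set where
  constructor isQuotient
  field
    cleared : x · ℕ→ℚ a ≡ ℕ→ℚ m

ℕ→ℚ-IsQuotient : ∀ n → IsQuotient (ℕ→ℚ n) n 1
ℕ→ℚ-IsQuotient n = isQuotient (ℚP.*-identityʳ (ℕ→ℚ n))

IsQuotient-· : ∀ {x y m n a b} → IsQuotient x m a → IsQuotient y n b →
  IsQuotient (x · y) (m * n) (a * b)
IsQuotient-· {x} {y} {m} {n} {a} {b} (isQuotient xa≡m) (isQuotient yb≡n) = isQuotient (begin
  x · y · ℕ→ℚ (a * b)            ≡⟨ cong (x · y ·_) (ℕ→ℚ-* a b) ⟩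
  x · y · (ℕ→ℚ a · ℕ→ℚ b)        ≡⟨ ·-interchange x y (ℕ→ℚ a) (ℕ→ℚ b) ⟩
  x · ℕ→ℚ a · (y · ℕ→ℚ b)        ≡⟨ cong₂ _·_ xa≡m yb≡n ⟩
  ℕ→ℚ m · ℕ→ℚ n                  ≡⟨ ℕ→ℚ-* m n ⟨
  ℕ→ℚ (m * n)                    ∎)
  where
  open ≡-Reasoning
  open import Algebra.Properties.CommutativeSemigroup
    (CommutativeMonoid.commutativeSemigroup ℚP.*-1-commutativeMonoid)
    using () renaming (interchange to ·-interchange)

IsQuotient-·ℕ→ℚ : ∀ {x m a} s → IsQuotient x m a → IsQuotient (x · ℕ→ℚ s) (m * s) a
IsQuotient-·ℕ→ℚ {a = a} s x≡m/a =
  subst (IsQuotient _ _) (*-identityʳ a) (IsQuotient-· x≡m/a (ℕ→ℚ-IsQuotient s))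

IsQuotient-÷' : ∀ {x y m n e} → 0 < n → IsQuotient x m e → IsQuotient y n e →
  IsQuotient (x ÷' y) m n
IsQuotient-÷' {x} {y} {m} {n} {e} 0<n (isQuotient xe≡m) (isQuotient ye≡n) = isQuotient (begin
  (x ÷' y) · ℕ→ℚ n              ≡⟨ cong ((x ÷' y) ·_) ye≡n ⟨
  (x ÷' y) · (y · ℕ→ℚ e)        ≡⟨ ℚP.*-assoc (x ÷' y) y (ℕ→ℚ e) ⟨
  (x ÷' y) · y · ℕ→ℚ e          ≡⟨ cong (_· ℕ→ℚ e) (÷'-·-cancel x y≢0) ⟩
  x · ℕ→ℚ e                     ≡⟨ xe≡m ⟩
  ℕ→ℚ m                         ∎)
  where
  open ≡-Reasoning
  y≢0 : y ≢ 0ℚ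
  y≢0 y≡0 = ℕ→ℚ-≢0 0<n (trans (sym ye≡n) (trans (cong (_· ℕ→ℚ e) y≡0) (ℚP.*-zeroˡ (ℕ→ℚ e))))

IsQuotient-scale : ∀ {x m a} d → IsQuotient x m a → IsQuotient x (m * d) (a * d)
IsQuotient-scale {x} {m} {a} d (isQuotient xa≡m) = isQuotient (begin
  x · ℕ→ℚ (a * d)          ≡⟨ cong (x ·_) (ℕ→ℚ-* a d) ⟩
  x · (ℕ→ℚ a · ℕ→ℚ d)      ≡⟨ ℚP.*-assoc x (ℕ→ℚ a) (ℕ→ℚ d) ⟨
  x · ℕ→ℚ a · ℕ→ℚ d        ≡⟨ cong (_· ℕ→ℚ d) xa≡m ⟩
  ℕ→ℚ m · ℕ→ℚ d            ≡⟨ ℕ→ℚ-* m d ⟨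
  ℕ→ℚ (m * d)              ∎)
  where open ≡-Reasoning

IsQuotient-≤ : ∀ {x y m n a b} → 0 < a → 0 < b →
  IsQuotient x m a → IsQuotient y n b → m * b ≤ n * a → x ≤ℚ y
IsQuotient-≤ {x} {y} {m} {n} {a} {b} 0<a 0<b x≡m/a y≡n/b mb≤na =
  ℚP.*-cancelʳ-≤-pos (ℕ→ℚ (a * b)) {{ℕ→ℚ-positive (*-mono-≤ 0<a 0<b)}}
    (subst₂ _≤ℚ_ (sym (IsQuotient.cleared (IsQuotient-scale b x≡m/a)))
                 (sym (IsQuotient.cleared y≡na/ab))
                 (ℕ→ℚ-mono-≤ mb≤na))
  where
  y≡na/ab : IsQuotient y (n * a) (a * b)
  y≡na/ab = subst (IsQuotient y (n * a)) (*-comm b a) (IsQuotient-scale a y≡n/b)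

m*[n∸o]≤m*n∸o : ∀ m n o .{{_ : NonZero m}} → m * (n ∸ o) ≤ m * n ∸ o
m*[n∸o]≤m*n∸o m n o = begin
  m * (n ∸ o)      ≡⟨ *-distribˡ-∸ m n o ⟩
  m * n ∸ m * o    ≤⟨ ∸-monoʳ-≤ (m * n) (m≤n*m o m) ⟩
  m * n ∸ o        ∎
  where open ≤-Reasoning

*-cross-mono-≤ : ∀ n d {a a′ b b′} → a * b′ ≤ a′ * b → n * a * (d * b′) ≤ n * a′ * (d * b)
*-cross-mono-≤ n d {a} {a′} {b} {b′} ab′≤a′b = subst₂ _≤_
  (solve 4 (λ n d a b′ → n :* d :* (a :* b′) := n :* a :* (d :* b′)) refl n d a b′)
  (solve 4 (λ n d a′ b → n :* d :* (a′ :* b) := n :* a′ :* (d :* b)) refl n d a′ b)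
  (*-monoʳ-≤ (n * d) ab′≤a′b)

*-swap-mono-≤ : ∀ n d {u r} → u ≤ r → n * (d * u) ≤ n * r * d
*-swap-mono-≤ n d {u} {r} u≤r = subst₂ _≤_
  (solve 3 (λ n d u → n :* d :* u := n :* (d :* u)) refl n d u)
  (solve 3 (λ n d r → n :* d :* r := n :* r :* d) refl n d r)
  (*-monoʳ-≤ (n * d) u≤r)

qFalling : (q n j : ℕ) → ℕ
qFalling q n zero = 1
qFalling q n (suc j) = qFalling q n j * (q ^ n ∸ q ^ j)

fvalNum : (q v k δ c y : ℕ) → ℕ
fvalNum q v k δ c y = qFalling q (v ∸ k) y * qFalling q k c * q ^ (c * (v ∸ k ∸ δ))

fvalDen : (q k δ c y : ℕ) → ℕ
fvalDen q k δ c y = qFalling q (k ∸ δ) c * qFalling q δ y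

module _ (q v k δ : ℕ) where
  private
    V = v ∸ k
    K = k ∸ δ
    e = v ∸ k ∸ δ

  fvalNum-suc-c : ∀ c y → fvalNum q v k δ (suc c) y ≡ fvalNum q v k δ c y * ((q ^ k ∸ q ^ c) * q ^ e)
  fvalNum-suc-c c y = trans (cong (A * (B * D) *_) (^-distribˡ-+-* q e (c * e)))
    (solve 5 (λ A B D E F → A :* (B :* D) :* (E :* F) := A :* B :* F :* (D :* E)) refl
      A B D (q ^ e) (q ^ (c * e)))
    where
    A = qFalling q V y
    B = qFalling q k c
    D = q ^ k ∸ q ^ c

  fvalNum-suc-y : ∀ c y → fvalNum q v k δ c (suc y) ≡ fvalNum q v k δ c y * (q ^ V ∸ q ^ y)
  fvalNum-suc-y c y = solve 4 (λ A X B F → A :* X :* B :* F := A :* B :* F :* X) refl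
    (qFalling q V y) (q ^ V ∸ q ^ y) (qFalling q k c) (q ^ (c * e))

  fvalDen-suc-c : ∀ c y → fvalDen q k δ (suc c) y ≡ fvalDen q k δ c y * (q ^ K ∸ q ^ c)
  fvalDen-suc-c c y = solve 3 (λ P U Q → P :* U :* Q := P :* Q :* U) refl
    (qFalling q K c) (q ^ K ∸ q ^ c) (qFalling q δ y)

  fvalDen-suc-y : ∀ c y → fvalDen q k δ c (suc y) ≡ fvalDen q k δ c y * (q ^ δ ∸ q ^ y)
  fvalDen-suc-y c y = sym (*-assoc (qFalling q K c) (qFalling q δ y) (q ^ δ ∸ q ^ y))

module _ {q : ℕ} (1<q : 1 < q) where

  private instance
    q-nonZero : NonZero q
    q-nonZero = >-nonZero (<-trans z<s 1<q)

  ^-∸-positive : ∀ {i j} → i < j → 0 < q ^ j ∸ q ^ i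
  ^-∸-positive i<j = m<n⇒0<n∸m (^-monoʳ-< q 1<q i<j)

  qFalling-positive : ∀ {n j} → j ≤ n → 0 < qFalling q n j
  qFalling-positive {j = zero} _ = z<s
  qFalling-positive {j = suc j} j<n = *-mono-≤ (qFalling-positive (<⇒≤ j<n)) (^-∸-positive j<n)

  gaussFactor-IsQuotient : ∀ {n m j} → j < m → m ≤ n →
    IsQuotient ((ℕ→ℚ (q ^ n) - ℕ→ℚ (q ^ j)) ÷' (ℕ→ℚ (q ^ m) - ℕ→ℚ (q ^ j)))
               (q ^ n ∸ q ^ j) (q ^ m ∸ q ^ j)
  gaussFactor-IsQuotient {n} {m} {j} j<m m≤n =
    subst₂ (λ x y → IsQuotient (x ÷' y) (q ^ n ∸ q ^ j) (q ^ m ∸ q ^ j))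
      (ℕ→ℚ-∸ (^-monoʳ-≤ q (<⇒≤ (<-≤-trans j<m m≤n)))) (ℕ→ℚ-∸ (^-monoʳ-≤ q (<⇒≤ j<m)))
      (IsQuotient-÷' (^-∸-positive j<m) (ℕ→ℚ-IsQuotient _) (ℕ→ℚ-IsQuotient _))

  gaussProd-IsQuotient : ∀ {n m j} → j ≤ m → m ≤ n →
    IsQuotient (gaussProd q n m j) (qFalling q n j) (qFalling q m j)
  gaussProd-IsQuotient {j = zero} _ _ = isQuotient (ℚP.*-identityˡ (ℕ→ℚ 1))
  gaussProd-IsQuotient {j = suc j} j<m m≤n =
    IsQuotient-· (gaussProd-IsQuotient (<⇒≤ j<m) m≤n) (gaussFactor-IsQuotient j<m m≤n)

  gauss-IsQuotient : ∀ {n m} → m ≤ n → IsQuotient (gauss q n m) (qFalling q n m) (qFalling q m m)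
  gauss-IsQuotient {n} {m} m≤n with m ≤? n
  ... | yes _ = gaussProd-IsQuotient ≤-refl m≤n
  ... | no m≰n = contradiction m≤n m≰n

  fvalDen-positive : ∀ {k δ c y} → c ≤ k ∸ δ → y ≤ δ → 0 < fvalDen q k δ c y
  fvalDen-positive c≤K y≤δ = *-mono-≤ (qFalling-positive c≤K) (qFalling-positive y≤δ)

  fval-IsQuotient : ∀ {v k δ c y} → y ≤ δ → δ ≤ v ∸ k → c ≤ k ∸ δ →
    IsQuotient (fval q v k δ c y) (fvalNum q v k δ c y) (fvalDen q k δ c y)
  fval-IsQuotient {v} {k} {δ} {c} {y} y≤δ δ≤V c≤K =
    IsQuotient-·ℕ→ℚ (q ^ (c * (v ∸ k ∸ δ)))
      (IsQuotient-÷' (fvalDen-positive c≤K y≤δ) numerator denominator)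
    where
    numerator : IsQuotient (gauss q (v ∸ k) y · gauss q k c)
      (qFalling q (v ∸ k) y * qFalling q k c) (qFalling q c c * qFalling q y y)
    numerator = subst (IsQuotient _ _) (*-comm (qFalling q y y) (qFalling q c c))
      (IsQuotient-· (gauss-IsQuotient (≤-trans y≤δ δ≤V))
                    (gauss-IsQuotient (≤-trans c≤K (m∸n≤m k δ))))
    denominator : IsQuotient (gauss q (k ∸ δ) c · gauss q δ y)
      (fvalDen q k δ c y) (qFalling q c c * qFalling q y y)
    denominator = IsQuotient-· (gauss-IsQuotient c≤K) (gauss-IsQuotient y≤δ)

  -- f(c + 1) ≥ f(c) cross-multiplied, for y(c + 1) = y(c) and for y(c + 1) = y(c) - 1.
  ^-ratio-same-y : ∀ {k K} c e → K ≤ k → q ^ K ∸ q ^ c ≤ (q ^ k ∸ q ^ c) * q ^ e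
  ^-ratio-same-y {k} {K} c e K≤k = begin
    q ^ K ∸ q ^ c              ≤⟨ ∸-monoˡ-≤ (q ^ c) (^-monoʳ-≤ q K≤k) ⟩
    q ^ k ∸ q ^ c              ≤⟨ m≤m*n (q ^ k ∸ q ^ c) (q ^ e) {{m^n≢0 q e}} ⟩
    (q ^ k ∸ q ^ c) * q ^ e    ∎
    where open ≤-Reasoning

  ^-ratio-pred-y : ∀ {V k δ c y} → δ ≤ V → δ ≤ k → y < δ →
    (q ^ V ∸ q ^ y) * (q ^ (k ∸ δ) ∸ q ^ c) ≤ (q ^ k ∸ q ^ c) * q ^ (V ∸ δ) * (q ^ δ ∸ q ^ y)
  ^-ratio-pred-y {V} {k} {δ} {c} {y} δ≤V δ≤k y<δ = begin
    (q ^ V ∸ q ^ y) * (q ^ K ∸ q ^ c)          ≤⟨ *-monoˡ-≤ _ (m∸n≤m (q ^ V) (q ^ y)) ⟩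
    q ^ V * (q ^ K ∸ q ^ c)                    ≡⟨ cong (_* (q ^ K ∸ q ^ c)) qV≡qδ*qe ⟩
    q ^ δ * q ^ e * (q ^ K ∸ q ^ c)            ≡⟨ *-rearrange (q ^ δ) (q ^ e) (q ^ K ∸ q ^ c) ⟩
    q ^ e * (q ^ δ * (q ^ K ∸ q ^ c))          ≤⟨ *-monoʳ-≤ (q ^ e) (m*[n∸o]≤m*n∸o (q ^ δ) (q ^ K) (q ^ c) {{m^n≢0 q δ}}) ⟩
    q ^ e * (q ^ δ * q ^ K ∸ q ^ c)            ≡⟨ cong (λ t → q ^ e * (t ∸ q ^ c)) qδ*qK≡qk ⟩
    q ^ e * (q ^ k ∸ q ^ c)                    ≤⟨ m≤m*n _ _ {{>-nonZero (^-∸-positive y<δ)}} ⟩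
    q ^ e * (q ^ k ∸ q ^ c) * (q ^ δ ∸ q ^ y)  ≡⟨ cong (_* (q ^ δ ∸ q ^ y)) (*-comm (q ^ e) (q ^ k ∸ q ^ c)) ⟩
    (q ^ k ∸ q ^ c) * q ^ e * (q ^ δ ∸ q ^ y)  ∎
    where
    open ≤-Reasoning
    K = k ∸ δ
    e = V ∸ δ
    *-rearrange : ∀ a b c → a * b * c ≡ b * (a * c)
    *-rearrange = solve 3 (λ a b c → a :* b :* c := b :* (a :* c)) refl
    qV≡qδ*qe : q ^ V ≡ q ^ δ * q ^ e
    qV≡qδ*qe = trans (cong (q ^_) (sym (m+[n∸m]≡n δ≤V))) (^-distribˡ-+-* q δ e)
    qδ*qK≡qk : q ^ δ * q ^ K ≡ q ^ k
    qδ*qK≡qk = trans (sym (^-distribˡ-+-* q δ K)) (cong (q ^_) (m+[n∸m]≡n δ≤k))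

  fval-≤-fval-suc : ∀ {v k δ c y y′} → δ ≤ k → δ ≤ v ∸ k → suc c ≤ k ∸ δ → y ≤ δ →
    y′ ≡ y ⊎ suc y′ ≡ y → fval q v k δ c y ≤ℚ fval q v k δ (suc c) y′
  fval-≤-fval-suc {v} {k} {δ} {c} {y} {y′} δ≤k δ≤V c<K y≤δ step =
    IsQuotient-≤ (fvalDen-positive (<⇒≤ c<K) y≤δ) (fvalDen-positive c<K y′≤δ)
      (fval-IsQuotient y≤δ δ≤V (<⇒≤ c<K)) (fval-IsQuotient y′≤δ δ≤V c<K) (cross step)
    where
    y′≤y : y′ ≡ y ⊎ suc y′ ≡ y → y′ ≤ y
    y′≤y (inj₁ refl) = ≤-refl
    y′≤y (inj₂ refl) = n≤1+n y′
    y′≤δ : y′ ≤ δ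
    y′≤δ = ≤-trans (y′≤y step) y≤δ
    cross : y′ ≡ y ⊎ suc y′ ≡ y →
      fvalNum q v k δ c y * fvalDen q k δ (suc c) y′ ≤ fvalNum q v k δ (suc c) y′ * fvalDen q k δ c y
    cross (inj₁ refl) = subst₂ _≤_
      (cong (fvalNum q v k δ c y *_) (sym (fvalDen-suc-c q v k δ c y)))
      (cong (_* fvalDen q k δ c y) (sym (fvalNum-suc-c q v k δ c y)))
      (*-swap-mono-≤ (fvalNum q v k δ c y) (fvalDen q k δ c y)
        (^-ratio-same-y c (v ∸ k ∸ δ) (m∸n≤m k δ)))
    cross (inj₂ refl) = subst₂ _≤_
      (cong₂ _*_ (sym (fvalNum-suc-y q v k δ c y′)) (sym (fvalDen-suc-c q v k δ c y′)))
      (cong₂ _*_ (sym (fvalNum-suc-c q v k δ c y′)) (sym (fvalDen-suc-y q v k δ c y′)))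
      (*-cross-mono-≤ (fvalNum q v k δ c y′) (fvalDen q k δ c y′)
        (^-ratio-pred-y {c = c} δ≤V δ≤k y≤δ))

prime-power>1 : ∀ {q} → IsPrimePower q → 1 < q
prime-power>1 (p , e , p-prime , 1≤e , refl) =
  ^-monoʳ-< p (nonTrivial⇒n>1 p {{prime⇒nonTrivial p-prime}}) 1≤e

lemma12 : (q d k v c : ℕ) (y : ℕ → ℕ) →
    IsPrimePower q →
    2 ∣ d →
    2 ≤ d / 2 → d / 2 ≤ k → 2 * k ≤ v →
    c + 1 ≤ k ∸ d / 2 →
    y c ≤ d / 2 →
    2 ≤ v ∸ k →
    (y (c + 1) ≡ y c ⊎ (1 ≤ y c × y (c + 1) + 1 ≡ y c)) →
    fval q v k (d / 2) c (y c) ≤ℚ fval q v k (d / 2) (c + 1) (y (c + 1))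
lemma12 q d k v c y q-prime-power _ _ δ≤k 2k≤v c<K y≤δ _ step with c + 1 | +-comm c 1
... | .(suc c) | refl =
  fval-≤-fval-suc (prime-power>1 q-prime-power) δ≤k (≤-trans δ≤k k≤v∸k) c<K y≤δ
    (map₂ (λ (_ , y′+1≡y) → trans (+-comm 1 _) y′+1≡y) step)
  where
  k≤v∸k : k ≤ v ∸ k
  k≤v∸k = subst (_≤ v ∸ k) (trans (m+n∸m≡n k (k + 0)) (+-identityʳ k)) (∸-monoˡ-≤ k 2k≤v)
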